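{- For every $n\ge 1$, each of the six maps $\Delta,\Gamma,\Theta,\Lambda,\Upsilon,\Psi : S_n\to S_n$ defined below is a bijection. For $t=t_1t_2\cdots t_n\in S_n$: (i) $\Delta(t)=s_1\cdots s_n$ with $s_i=(t_i-t_{i+1}) \bmod i$ for $1\le i<n$ and $s_n=t_n$; (ii) $\Gamma(t)=s_1\cdots s_n$ with $s_1=0$ and $s_i=(t_{i-1}-t_i)\bmod i$ for $1<i\le n$; (iii) $\Theta(t)=s_1\cdots s_n$ with $s_1=0$ and, for $1<i\le n$, $s_i=t_{i-1}-t_i$ if $t_{i-1}\ge t_i$ and $s_i=t_i$ if $t_{i-1}<t_i$; (iv) $\Lambda(t)=s_1\cdots s_n$ with $s_1=0$ and, for $1<i\le n$, $s_i=t_i$ if $t_{i-1}\ge t_i$ and $s_i=i+t_{i-1}-t_i$ if $t_{i-1}<t_i$; (v) $\Upsilon(t)=s_1\cdots s_n$ with, for $1\le i<n$, $s_i=i-t_i-1$ if $t_i<t_{i+1}$ and $s_i=t_i-t_{i+1}$ if $t_i\ge t_{i+1}$, and $s_n=t_n$; (vi) $\Psi(t)=s_1\cdots s_n$ with, for $1\le i<n$, $s_i=t_{i+1}-t_i-1$ if $t_i<t_{i+1}$ and $s_i=t_i$ if $t_i\ge t_{i+1}$, and $s_n=t_n$.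
   Context: A sequence of integers $t_1t_2\cdots t_n$ is subexcedant if $0\le t_i\le i-1$ for all $1\le i\le n$; $S_n$ denotes the set of all subexcedant sequences of length $n$, i.e. $S_n=\{0\}\times\{0,1\}\times\cdots\times\{0,1,\dots,n-1\}$. Here $x\bmod i$ denotes the representative in $\{0,1,\dots,i-1\}$. -}

module Defs where

open import Data.Nat using (ℕ; zero; suc; _+_; _∸_; _≤_; _<_; _≤?_; _<?_; z≤n; s≤s)
open import Data.Nat.Properties
open import Data.Fin using (Fin; toℕ; fromℕ<)
import Data.Fin as Fin
open import Data.Fin.Properties using (toℕ<n)
open import Data.Integer using (ℤ; +_; _-_; _%ℕ_)
open import Data.Integer.DivMod using (n%ℕd<d)
open import Relation.Nullary using (yes; no)
open import Relation.Binary.PropositionalEquality using (_≡_; refl)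

-- Subexcedant sequences of length n, built by appending on the right:
-- an element of S (suc n) is an element of S n followed by t_{n+1} ∈ {0,…,n}.
infixl 5 _∷ʳ_
data S : ℕ → Set where
  []   : S 0
  _∷ʳ_ : ∀ {n} → S n → Fin (suc n) → S (suc n)

-- get t k _  is the entry t_{k+1} (positions are 1-based in the paper,
-- k is the 0-based index), which lies in {0,…,k}.
get : ∀ {n} → S n → (k : ℕ) → k < n → Fin (suc k)
get {suc n} (t ∷ʳ x) k p with k ≟ n
... | yes refl = x
... | no k≢n   = get t k (≤∧≢⇒< (≤-pred p) k≢n)

val : ∀ {n} → S n → (k : ℕ) → k < n → ℕ
val t k p = toℕ (get t k p)

tabulate : ∀ {n} → ((k : ℕ) → k < n → Fin (suc k)) → S n
tabulate {zero}  f = []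
tabulate {suc n} f = tabulate (λ k p → f k (m<n⇒m<1+n p)) ∷ʳ f n (n<1+n n)

private
  val<  : ∀ {n} (t : S n) k p → val t k p < suc k
  val<  t k p = toℕ<n (get t k p)

  ∸<    : ∀ a b k → a < suc k → a ∸ b < suc k
  ∸<    a b k h = ≤-<-trans (m∸n≤m a b) h

  up    : ∀ {a k} → a < suc k → a < suc (suc k)
  up h  = m<n⇒m<1+n h

  lam<  : ∀ m a b → a < b → (suc m + a) ∸ b < suc m
  lam<  m a b a<b = ≤-<-trans (∸-monoʳ-≤ (suc m + a) a<b) (≤-<-trans (≤-reflexive (eq m a)) (n<1+n m))
    where
    eq : ∀ m a → (suc m + a) ∸ suc a ≡ m
    eq m a = m+n∸n≡m m a

  ups<  : ∀ k a → suc k ∸ a ∸ 1 < suc k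
  ups<  k a = s≤s (∸-monoˡ-≤ 1 (m∸n≤m (suc k) a))

  psi<  : ∀ k a b → b < suc (suc k) → b ∸ a ∸ 1 < suc k
  psi<  k a b h = s≤s (∸-monoˡ-≤ 1 (≤-trans (m∸n≤m b a) (≤-pred h)))

  modFin : ℕ → ℕ → (k : ℕ) → Fin (suc k)
  modFin x y k = fromℕ< (n%ℕd<d ((+ x) - (+ y)) (suc k))

-- In each, position i = k+1 (k 0-based),
-- t_i = val t k _, t_{i-1} = val t k' _ with k = suc k', t_{i+1} = val t (suc k) _.
-- All subtractions ∸ below are only used where the true difference is ≥ 0.

Δ : ∀ n → S n → S n
Δ n t = tabulate f
  where
  f : (k : ℕ) → k < n → Fin (suc k)
  f k p with suc k <? n
  ... | yes q = modFin (val t k p) (val t (suc k) q) k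
  ... | no _  = get t k p

Γ : ∀ n → S n → S n
Γ n t = tabulate f
  where
  f : (k : ℕ) → k < n → Fin (suc k)
  f zero     p = Fin.zero
  f (suc k') p = modFin (val t k' (<-trans (n<1+n k') p)) (val t (suc k') p) (suc k')

Θ : ∀ n → S n → S n
Θ n t = tabulate f
  where
  f : (k : ℕ) → k < n → Fin (suc k)
  f zero     p = Fin.zero
  f (suc k') p with val t k' (<-trans (n<1+n k') p) | val< t k' (<-trans (n<1+n k') p)
                  | val t (suc k') p | val< t (suc k') p
  ... | a | ha | b | hb with b ≤? a
  ...   | yes _ = fromℕ< {a ∸ b} (up (∸< a b k' ha))
  ...   | no  _ = fromℕ< {b} hb

Λ : ∀ n → S n → S n
Λ n t = tabulate f
  where
  f : (k : ℕ) → k < n → Fin (suc k)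
  f zero     p = Fin.zero
  f (suc k') p with val t k' (<-trans (n<1+n k') p)
                  | val t (suc k') p | val< t (suc k') p
  ... | a | b | hb with a <? b
  ...   | no  _   = fromℕ< {b} hb
  ...   | yes a<b = fromℕ< {suc (suc k') + a ∸ b} (lam< (suc k') a b a<b)

Υ : ∀ n → S n → S n
Υ n t = tabulate f
  where
  f : (k : ℕ) → k < n → Fin (suc k)
  f k p with suc k <? n
  ... | no _  = get t k p
  ... | yes q with val t k p | val< t k p | val t (suc k) q
  ...   | a | ha | b with a <? b
  ...     | yes _ = fromℕ< {suc k ∸ a ∸ 1} (ups< k a)
  ...     | no  _ = fromℕ< {a ∸ b} (∸< a b k ha)

Ψ : ∀ n → S n → S n
Ψ n t = tabulate f
  where
  f : (k : ℕ) → k < n → Fin (suc k)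
  f k p with suc k <? n
  ... | no _  = get t k p
  ... | yes q with val t k p | val< t k p | val t (suc k) q | val< t (suc k) q
  ...   | a | ha | b | hb with a <? b
  ...     | yes _ = fromℕ< {b ∸ a ∸ 1} (psi< k a b hb)
  ...     | no  _ = fromℕ< {a} ha

-- Each map computes s_i from two neighbouring entries of t and is, for the neighbour held fixed,
-- injective in t_i: for Γ, Θ, Λ the neighbour is t_{i-1} (and s_1 = 0), for Δ, Υ, Ψ it is
-- t_{i+1} (and s_n = t_n).  An injective self-map of {0,…,i-1} is onto, so t can be recovered
-- from s one entry at a time, left to right in the first case and right to left in the second;
-- by induction on the length both kinds of map are bijections of S_n.  For Δ and Γ the
-- injectivity comes from the fact that integers less than i apart with equal residues mod i are
-- equal; for the other four it is a case analysis whose two branches take disjoint values.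

module Submission where

open import Data.Fin using (Fin; zero; toℕ; fromℕ<; punchOut)
open import Data.Fin.Properties
  using (toℕ<n; toℕ-injective; fromℕ<-injective; any?; punchOut-injective; injective⇒≤)
  renaming (_≟_ to _≟ᶠ_)
open import Data.Integer as ℤ using (ℤ; +_; 0ℤ; _%ℕ_; _/ℕ_)
open import Data.Integer.DivMod using (n%ℕd<d; a≡a%ℕn+[a/ℕn]*n)
open import Data.Integer.Properties
  using (+-injective; +-inverseʳ; i-j≡0⇒i≡j; ∣i∣≡0⇒i≡0; abs-*; [+m]-[+n]≡m⊖n; ∣m⊝n∣≤m⊔n)
open import Data.Integer.Tactic.RingSolver using (solve-∀)
open import Data.Nat using (ℕ; zero; suc; _+_; _∸_; _≤_; _<_; _≤?_; _<?_; z≤n; s≤s; NonZero)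
open import Data.Nat.Divisibility using (_∣_; divides; >⇒∤)
open import Data.Nat.Properties
open import Data.Product using (∃; _×_; _,_; proj₁; proj₂)
open import Function.Base using (_∋_; _∘_)
open import Function.Consequences.Propositional using (strictlySurjective⇒surjective)
open import Function.Definitions using (Injective; StrictlySurjective; Bijective)
open import Relation.Nullary using (Dec; yes; no; contradiction)
open import Relation.Binary.PropositionalEquality

open import Defs

init : ∀ {n} → S (suc n) → S n
init (t ∷ʳ _) = t

last : ∀ {n} → S (suc n) → Fin (suc n)
last (_ ∷ʳ x) = x

S₁-irrelevant : (t u : S 1) → t ≡ u
S₁-irrelevant ([] ∷ʳ zero) ([] ∷ʳ zero) = refl

get-irrelevant : ∀ {n} (t : S n) k (p q : k < n) → get t k p ≡ get t k q
get-irrelevant t k p q = cong (get t k) (<-irrelevant p q)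

get-∷ʳ-last : ∀ {n} (t : S n) x (p : n < suc n) → get (t ∷ʳ x) n p ≡ x
get-∷ʳ-last {n} t x p with n ≟ n
... | yes refl = refl
... | no  n≢n  = contradiction refl n≢n

get-∷ʳ-< : ∀ {n} (t : S n) x k (p : k < suc n) (q : k < n) → get (t ∷ʳ x) k p ≡ get t k q
get-∷ʳ-< {n} t x k p q with k ≟ n
... | yes refl = contradiction q (<-irrefl refl)
... | no  _    = get-irrelevant t k _ q

tabulate-cong : ∀ {n} {f g : (k : ℕ) → k < n → Fin (suc k)} →
                (∀ k p → f k p ≡ g k p) → tabulate f ≡ tabulate g
tabulate-cong {zero}  f≗g = refl
tabulate-cong {suc n} f≗g = cong₂ _∷ʳ_ (tabulate-cong λ k p → f≗g k _) (f≗g n _)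

get-tabulate : ∀ {n} (f : (k : ℕ) → k < n → Fin (suc k)) k p → get (tabulate f) k p ≡ f k p
get-tabulate {suc n} f k p with k ≟ n
... | yes refl = cong (f n) (<-irrelevant _ _)
... | no  _    = trans (get-tabulate (λ j q → f j (m<n⇒m<1+n q)) k _) (cong (f k) (<-irrelevant _ _))

tabulate-unique : ∀ {n} (t : S n) {f : (k : ℕ) → k < n → Fin (suc k)} →
                  (∀ k p → get t k p ≡ f k p) → t ≡ tabulate f
tabulate-unique []               _   = refl
tabulate-unique {suc n} (t ∷ʳ x) t≗f = cong₂ _∷ʳ_
  (tabulate-unique t λ k p → trans (sym (get-∷ʳ-< t x k _ p)) (t≗f k _))
  (trans (sym (get-∷ʳ-last t x _)) (t≗f n _))

injective⇒strictlySurjective : ∀ {n} {f : Fin n → Fin n} →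
                               Injective _≡_ _≡_ f → StrictlySurjective _≡_ f
injective⇒strictlySurjective {suc n} {f} f-injective y with any? (λ x → f x ≟ᶠ y)
... | yes hit  = hit
... | no  miss = contradiction (injective⇒≤ punchOut∘f-injective) (<-irrefl refl)
  where
  y≢f : ∀ x → y ≢ f x
  y≢f x y≡fx = miss (x , sym y≡fx)

  punchOut∘f-injective : Injective _≡_ _≡_ (λ x → punchOut (y≢f x))
  punchOut∘f-injective eq = f-injective (punchOut-injective (y≢f _) (y≢f _) eq)

bijective-resp-≗ : ∀ {A B : Set} {f g : A → B} → f ≗ g → Bijective _≡_ _≡_ g → Bijective _≡_ _≡_ f
bijective-resp-≗ f≗g (g-injective , g-surjective) =
  (λ fx≡fy → g-injective (trans (sym (f≗g _)) (trans fx≡fy (f≗g _)))) ,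
  (λ y → proj₁ (g-surjective y) , λ z≡x → trans (f≗g _) (proj₂ (g-surjective y) z≡x))

module Backward
  (φ : ℕ → ℕ → ℕ → ℕ)
  (φ< : ∀ {k a b} → a < suc k → b < suc (suc k) → φ k a b < suc (suc k))
  (φ-injectiveʳ : ∀ {k a b b′} → a < suc k → b < suc (suc k) → b′ < suc (suc k) →
                  φ k a b ≡ φ k a b′ → b ≡ b′)
  where

  step : ∀ k → Fin (suc k) → Fin (suc (suc k)) → Fin (suc (suc k))
  step k a b = fromℕ< (φ< (toℕ<n a) (toℕ<n b))

  step-injectiveʳ : ∀ k a → Injective _≡_ _≡_ (step k a)
  step-injectiveʳ k a {b} {b′} eq =
    toℕ-injective (φ-injectiveʳ (toℕ<n a) (toℕ<n b) (toℕ<n b′) (fromℕ<-injective _ _ _ _ eq))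

  entry : ∀ {n} → S n → (k : ℕ) → k < n → Fin (suc k)
  entry t zero    _ = zero
  entry t (suc k) p = step k (get t k (<-trans (n<1+n k) p)) (get t (suc k) p)

  backward : ∀ n → S n → S n
  backward n t = tabulate (entry t)

  entry-∷ʳ : ∀ {n} (t : S n) x k (p : k < suc n) (q : k < n) → entry (t ∷ʳ x) k p ≡ entry t k q
  entry-∷ʳ t x zero    p q = refl
  entry-∷ʳ t x (suc k) p q = cong₂ (step k) (get-∷ʳ-< t x k _ _) (get-∷ʳ-< t x (suc k) p q)

  backward-∷ʳ : ∀ {m} (t : S m) a b →
                backward (suc (suc m)) (t ∷ʳ a ∷ʳ b) ≡ backward (suc m) (t ∷ʳ a) ∷ʳ step m a b
  backward-∷ʳ {m} t a b = cong₂ _∷ʳ_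
    (tabulate-cong λ k p → entry-∷ʳ (t ∷ʳ a) b k (m<n⇒m<1+n p) p)
    (cong₂ (step m) (trans (get-∷ʳ-< (t ∷ʳ a) b m _ (n<1+n m)) (get-∷ʳ-last t a _))
                    (get-∷ʳ-last (t ∷ʳ a) b _))

  backward-injective : ∀ n → Injective _≡_ _≡_ (backward n)
  backward-injective zero          {[]}           {[]}             _  = refl
  backward-injective (suc zero)    {t}            {u}              _  = S₁-irrelevant t u
  backward-injective (suc (suc m)) {t ∷ʳ a ∷ʳ b} {u ∷ʳ a′ ∷ʳ b′} eq =
    extend (backward-injective (suc m) (cong init eq′)) (cong last eq′)
    where
    eq′ : backward _ (t ∷ʳ a) ∷ʳ step m a b ≡ backward _ (u ∷ʳ a′) ∷ʳ step m a′ b′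
    eq′ = trans (sym (backward-∷ʳ t a b)) (trans eq (backward-∷ʳ u a′ b′))

    extend : t ∷ʳ a ≡ u ∷ʳ a′ → step m a b ≡ step m a′ b′ → t ∷ʳ a ∷ʳ b ≡ u ∷ʳ a′ ∷ʳ b′
    extend refl step≡ = cong (t ∷ʳ a ∷ʳ_) (step-injectiveʳ m a step≡)

  backward-surjective : ∀ n → StrictlySurjective _≡_ (backward n)
  backward-surjective zero          []       = [] , refl
  backward-surjective (suc zero)    s        = s , S₁-irrelevant _ s
  backward-surjective (suc (suc m)) (s ∷ʳ c)
    with t ∷ʳ a , Bt≡s ← backward-surjective (suc m) s
    with b , step≡c ← injective⇒strictlySurjective (step-injectiveʳ m a) c
    = t ∷ʳ a ∷ʳ b , trans (backward-∷ʳ t a b) (cong₂ _∷ʳ_ Bt≡s step≡c)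

  backward-bijective : ∀ n → Bijective _≡_ _≡_ (backward n)
  backward-bijective n = backward-injective n , strictlySurjective⇒surjective (backward-surjective n)

module Forward
  (φ : ℕ → ℕ → ℕ → ℕ)
  (φ< : ∀ {k a b} → a < suc k → b < suc (suc k) → φ k a b < suc k)
  (φ-injectiveˡ : ∀ {k a a′ b} → a < suc k → a′ < suc k → b < suc (suc k) →
                  φ k a b ≡ φ k a′ b → a ≡ a′)
  where

  step : ∀ k → Fin (suc k) → Fin (suc (suc k)) → Fin (suc k)
  step k a b = fromℕ< (φ< (toℕ<n a) (toℕ<n b))

  step-injectiveˡ : ∀ k b → Injective _≡_ _≡_ (λ a → step k a b)
  step-injectiveˡ k b {a} {a′} eq =
    toℕ-injective (φ-injectiveˡ (toℕ<n a) (toℕ<n a′) (toℕ<n b) (fromℕ<-injective _ _ _ _ eq))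

  entry : ∀ {n} → S n → (k : ℕ) → k < n → Dec (suc k < n) → Fin (suc k)
  entry t k p (yes q) = step k (get t k p) (get t (suc k) q)
  entry t k p (no  _) = get t k p

  forward : ∀ n → S n → S n
  forward n t = tabulate (λ k p → entry t k p (suc k <? n))

  entry-yes : ∀ {n} (t : S n) k p (q : suc k < n) d → entry t k p d ≡ step k (get t k p) (get t (suc k) q)
  entry-yes t k p q (yes q′) = cong (step k (get t k p)) (get-irrelevant t (suc k) q′ q)
  entry-yes t k p q (no ¬q)  = contradiction q ¬q

  entry-last : ∀ {n} (t : S n) x p d → entry (t ∷ʳ x) n p d ≡ x
  entry-last t x p (yes q) = contradiction q (<-irrefl refl)
  entry-last t x p (no  _) = get-∷ʳ-last t x p

  entry-∷ʳ : ∀ {n} (t : S n) x k p p′ (q : suc k < n) d d′ → entry (t ∷ʳ x) k p d ≡ entry t k p′ d′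
  entry-∷ʳ t x k p p′ q d d′ = begin
    entry (t ∷ʳ x) k p d                                  ≡⟨ entry-yes (t ∷ʳ x) k p (m<n⇒m<1+n q) d ⟩
    step k (get (t ∷ʳ x) k p) (get (t ∷ʳ x) (suc k) _)   ≡⟨ cong₂ (step k) (get-∷ʳ-< t x k p p′)
                                                                             (get-∷ʳ-< t x (suc k) _ q) ⟩
    step k (get t k p′) (get t (suc k) q)                 ≡⟨ entry-yes t k p′ q d′ ⟨
    entry t k p′ d′                                       ∎
    where open ≡-Reasoning

  forward-∷ʳ-last : ∀ {m} (t : S m) a → forward (suc m) (t ∷ʳ a) ≡ init (forward (suc m) (t ∷ʳ a)) ∷ʳ a
  forward-∷ʳ-last {m} t a = cong (init (forward _ (t ∷ʳ a)) ∷ʳ_) (entry-last t a _ (suc m <? suc m))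

  forward-∷ʳ : ∀ {m} (t : S m) a b →
               forward (suc (suc m)) (t ∷ʳ a ∷ʳ b) ≡ init (forward (suc m) (t ∷ʳ a)) ∷ʳ step m a b ∷ʳ b
  forward-∷ʳ {m} t a b = cong₂ _∷ʳ_
    (cong₂ _∷ʳ_ (tabulate-cong λ k p → entry-∷ʳ (t ∷ʳ a) b k _ _ (s≤s p) (suc k <? suc (suc m)) (suc k <? suc m))
                (penultimate _ (suc m <? suc (suc m))))
    (entry-last (t ∷ʳ a) b _ (suc (suc m) <? suc (suc m)))
    where
    penultimate : ∀ p d → entry (t ∷ʳ a ∷ʳ b) m p d ≡ step m a b
    penultimate p d = trans (entry-yes (t ∷ʳ a ∷ʳ b) m p ≤-refl d)
      (cong₂ (step m) (trans (get-∷ʳ-< (t ∷ʳ a) b m p (n<1+n m)) (get-∷ʳ-last t a _))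
                      (get-∷ʳ-last (t ∷ʳ a) b _))

  forward-injective : ∀ n → Injective _≡_ _≡_ (forward n)
  forward-injective zero          {[]}           {[]}             _  = refl
  forward-injective (suc zero)    {t}            {u}              _  = S₁-irrelevant t u
  forward-injective (suc (suc m)) {t ∷ʳ a ∷ʳ b} {u ∷ʳ a′ ∷ʳ b′} eq =
    cong₂ _∷ʳ_ (forward-injective (suc m) (prefix (a≡a′ b≡b′ (cong (last ∘ init) eq′)))) b≡b′
    where
    open ≡-Reasoning
    eq′ : init (forward _ (t ∷ʳ a)) ∷ʳ step m a b ∷ʳ b ≡ init (forward _ (u ∷ʳ a′)) ∷ʳ step m a′ b′ ∷ʳ b′
    eq′ = trans (sym (forward-∷ʳ t a b)) (trans eq (forward-∷ʳ u a′ b′))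

    b≡b′ : b ≡ b′
    b≡b′ = cong last eq′

    a≡a′ : b ≡ b′ → step m a b ≡ step m a′ b′ → a ≡ a′
    a≡a′ refl = step-injectiveˡ m b

    prefix : a ≡ a′ → forward _ (t ∷ʳ a) ≡ forward _ (u ∷ʳ a′)
    prefix refl = begin
      forward _ (t ∷ʳ a)              ≡⟨ forward-∷ʳ-last t a ⟩
      init (forward _ (t ∷ʳ a)) ∷ʳ a  ≡⟨ cong (_∷ʳ a) (cong (init ∘ init) eq′) ⟩
      init (forward _ (u ∷ʳ a)) ∷ʳ a  ≡⟨ forward-∷ʳ-last u a ⟨
      forward _ (u ∷ʳ a)              ∎

  forward-surjective : ∀ n → StrictlySurjective _≡_ (forward n)
  forward-surjective zero          []            = [] , refl
  forward-surjective (suc zero)    s             = s , S₁-irrelevant _ s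
  forward-surjective (suc (suc m)) (s ∷ʳ x ∷ʳ c) =
    let a , step≡x = injective⇒strictlySurjective (step-injectiveˡ m c) x
    in  extend a step≡x (forward-surjective (suc m) (s ∷ʳ a))
    where
    extend : ∀ a → step m a c ≡ x → ∃ (λ t → forward _ t ≡ s ∷ʳ a) →
             ∃ λ t → forward _ t ≡ s ∷ʳ x ∷ʳ c
    extend a step≡x (t ∷ʳ a′ , Ft≡s)
      with refl ← trans (sym (cong last (forward-∷ʳ-last t a′))) (cong last Ft≡s)
      = t ∷ʳ a ∷ʳ c , trans (forward-∷ʳ t a c) (cong₂ (λ v y → init v ∷ʳ y ∷ʳ c) Ft≡s step≡x)

  forward-bijective : ∀ n → Bijective _≡_ _≡_ (forward n)
  forward-bijective n = forward-injective n , strictlySurjective⇒surjective (forward-surjective n)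

m∣n∧n<m⇒n≡0 : ∀ {m n} → m ∣ n → n < m → n ≡ 0
m∣n∧n<m⇒n≡0 {n = zero}  _   _   = refl
m∣n∧n<m⇒n≡0 {n = suc _} m∣n n<m = contradiction m∣n (>⇒∤ n<m)

[i+x*m]-[i+y*m]≡[x-y]*m : ∀ i x y m → (i ℤ.+ x ℤ.* m) ℤ.- (i ℤ.+ y ℤ.* m) ≡ (x ℤ.- y) ℤ.* m
[i+x*m]-[i+y*m]≡[x-y]*m = solve-∀

[i-k]-[j-k]≡i-j : ∀ i j k → (i ℤ.- k) ℤ.- (j ℤ.- k) ≡ i ℤ.- j
[i-k]-[j-k]≡i-j = solve-∀

[k-i]-[k-j]≡j-i : ∀ i j k → (k ℤ.- i) ℤ.- (k ℤ.- j) ≡ j ℤ.- i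
[k-i]-[k-j]≡j-i = solve-∀

-- Integers with the same residue differ by a multiple of m, which must vanish when it is below m.
%ℕ-injective : ∀ m .{{_ : NonZero m}} {i j : ℤ} → ℤ.∣ i ℤ.- j ∣ < m → i %ℕ m ≡ j %ℕ m → i ≡ j
%ℕ-injective m {i} {j} ∣i-j∣<m i≡j[m] = i-j≡0⇒i≡j i j (∣i∣≡0⇒i≡0 (m∣n∧n<m⇒n≡0 m∣∣i-j∣ ∣i-j∣<m))
  where
  open ≡-Reasoning
  q : ℤ
  q = i /ℕ m ℤ.- j /ℕ m

  i-j≡q*m : i ℤ.- j ≡ q ℤ.* + m
  i-j≡q*m = begin
    i ℤ.- j
      ≡⟨ cong₂ ℤ._-_ (a≡a%ℕn+[a/ℕn]*n i m) (a≡a%ℕn+[a/ℕn]*n j m) ⟩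
    (+ (i %ℕ m) ℤ.+ i /ℕ m ℤ.* + m) ℤ.- (+ (j %ℕ m) ℤ.+ j /ℕ m ℤ.* + m)
      ≡⟨ cong (λ r → (+ (i %ℕ m) ℤ.+ i /ℕ m ℤ.* + m) ℤ.- (+ r ℤ.+ j /ℕ m ℤ.* + m)) (sym i≡j[m]) ⟩
    (+ (i %ℕ m) ℤ.+ i /ℕ m ℤ.* + m) ℤ.- (+ (i %ℕ m) ℤ.+ j /ℕ m ℤ.* + m)
      ≡⟨ [i+x*m]-[i+y*m]≡[x-y]*m (+ (i %ℕ m)) (i /ℕ m) (j /ℕ m) (+ m) ⟩
    q ℤ.* + m
      ∎

  m∣∣i-j∣ : m ∣ ℤ.∣ i ℤ.- j ∣
  m∣∣i-j∣ = divides ℤ.∣ q ∣ (trans (cong ℤ.∣_∣ i-j≡q*m) (abs-* q (+ m)))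

∣[+a]-[+b]∣< : ∀ {m a b} → a < m → b < m → ℤ.∣ + a ℤ.- + b ∣ < m
∣[+a]-[+b]∣< {a = a} {b} a<m b<m = subst (_< _) (cong ℤ.∣_∣ (sym ([+m]-[+n]≡m⊖n a b)))
  (≤-<-trans (∣m⊝n∣≤m⊔n a b) (⊔-pres-<m a<m b<m))

-%ℕ-injectiveˡ : ∀ {m} .{{_ : NonZero m}} {a a′} (j : ℤ) → a < m → a′ < m →
                 (+ a ℤ.- j) %ℕ m ≡ (+ a′ ℤ.- j) %ℕ m → a ≡ a′
-%ℕ-injectiveˡ {m} {a} {a′} j a<m a′<m eq = +-injective (i-j≡0⇒i≡j (+ a) (+ a′) (begin
  + a ℤ.- + a′                   ≡⟨ [i-k]-[j-k]≡i-j (+ a) (+ a′) j ⟨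
  (+ a ℤ.- j) ℤ.- (+ a′ ℤ.- j)   ≡⟨ cong (ℤ._- (+ a′ ℤ.- j)) (%ℕ-injective m {+ a ℤ.- j} bound eq) ⟩
  (+ a′ ℤ.- j) ℤ.- (+ a′ ℤ.- j)  ≡⟨ +-inverseʳ (+ a′ ℤ.- j) ⟩
  0ℤ                             ∎))
  where
  open ≡-Reasoning
  bound : ℤ.∣ (+ a ℤ.- j) ℤ.- (+ a′ ℤ.- j) ∣ < m
  bound = subst (λ x → ℤ.∣ x ∣ < m) (sym ([i-k]-[j-k]≡i-j (+ a) (+ a′) j)) (∣[+a]-[+b]∣< a<m a′<m)

-%ℕ-injectiveʳ : ∀ {m} .{{_ : NonZero m}} {b b′} (i : ℤ) → b < m → b′ < m →
                 (i ℤ.- + b) %ℕ m ≡ (i ℤ.- + b′) %ℕ m → b ≡ b′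
-%ℕ-injectiveʳ {m} {b} {b′} i b<m b′<m eq = sym (+-injective (i-j≡0⇒i≡j (+ b′) (+ b) (begin
  + b′ ℤ.- + b                  ≡⟨ [k-i]-[k-j]≡j-i (+ b) (+ b′) i ⟨
  (i ℤ.- + b) ℤ.- (i ℤ.- + b′)  ≡⟨ cong (ℤ._- (i ℤ.- + b′)) (%ℕ-injective m {i ℤ.- + b} bound eq) ⟩
  (i ℤ.- + b′) ℤ.- (i ℤ.- + b′) ≡⟨ +-inverseʳ (i ℤ.- + b′) ⟩
  0ℤ                            ∎)))
  where
  open ≡-Reasoning
  bound : ℤ.∣ (i ℤ.- + b) ℤ.- (i ℤ.- + b′) ∣ < m
  bound = subst (λ x → ℤ.∣ x ∣ < m) (sym ([k-i]-[k-j]≡j-i (+ b) (+ b′) i)) (∣[+a]-[+b]∣< b′<m b<m)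

Θ-step : ℕ → ℕ → ℕ
Θ-step a b with b ≤? a
... | yes _ = a ∸ b
... | no  _ = b

Θ-step< : ∀ {k a b} → a < suc k → b < suc (suc k) → Θ-step a b < suc (suc k)
Θ-step< {a = a} {b} a<1+k b<2+k with b ≤? a
... | yes _ = m<n⇒m<1+n (≤-<-trans (m∸n≤m a b) a<1+k)
... | no  _ = b<2+k

Θ-step-injectiveʳ : ∀ {a b b′} → Θ-step a b ≡ Θ-step a b′ → b ≡ b′
Θ-step-injectiveʳ {a} {b} {b′} eq with b ≤? a | b′ ≤? a
... | yes b≤a | yes b′≤a = ∸-cancelˡ-≡ b≤a b′≤a eq
... | no  _   | no  _    = eq
... | yes _   | no  b′≰a = contradiction (subst (_≤ a) eq (m∸n≤m a b)) b′≰a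
... | no  b≰a | yes _    = contradiction (subst (_≤ a) (sym eq) (m∸n≤m a b′)) b≰a

Λ-step : ℕ → ℕ → ℕ → ℕ
Λ-step k a b with a <? b
... | yes _ = suc (suc k) + a ∸ b
... | no  _ = b

Λ-step< : ∀ {k a b} → a < suc k → b < suc (suc k) → Λ-step k a b < suc (suc k)
Λ-step< {k} {a} {b} _ b<2+k with a <? b
... | yes a<b = s≤s (begin
      suc (suc k) + a ∸ b      ≤⟨ ∸-monoʳ-≤ (suc (suc k) + a) a<b ⟩
      suc (suc k) + a ∸ suc a  ≡⟨ m+n∸n≡m (suc k) a ⟩
      suc k                    ∎)
  where open ≤-Reasoning
... | no  _   = b<2+k

a<[2+k+a]∸b : ∀ {k a b} → b < suc (suc k) → a < suc (suc k) + a ∸ b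
a<[2+k+a]∸b {k} {a} {b} b<2+k = m+n≤o⇒m≤o∸n (suc a) (begin
  suc a + b          ≤⟨ +-monoʳ-≤ (suc a) (≤-pred b<2+k) ⟩
  suc a + suc k      ≡⟨ +-comm (suc a) (suc k) ⟩
  suc k + suc a      ≡⟨ +-suc (suc k) a ⟩
  suc (suc k) + a    ∎)
  where open ≤-Reasoning

Λ-step-injectiveʳ : ∀ {k a b b′} → b < suc (suc k) → b′ < suc (suc k) →
                    Λ-step k a b ≡ Λ-step k a b′ → b ≡ b′
Λ-step-injectiveʳ {k} {a} {b} {b′} b<2+k b′<2+k eq with a <? b | a <? b′
... | yes _   | yes _    = ∸-cancelˡ-≡ (≤-trans (<⇒≤ b<2+k) (m≤m+n _ a)) (≤-trans (<⇒≤ b′<2+k) (m≤m+n _ a)) eq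
... | no  _   | no  _    = eq
... | yes _   | no  a≮b′ = contradiction (subst (a <_) eq (a<[2+k+a]∸b b<2+k)) a≮b′
... | no  a≮b | yes _    = contradiction (subst (a <_) (sym eq) (a<[2+k+a]∸b b′<2+k)) a≮b

Υ-step : ℕ → ℕ → ℕ → ℕ
Υ-step k a b with a <? b
... | yes _ = suc k ∸ a ∸ 1
... | no  _ = a ∸ b

Υ-step< : ∀ {k a b} → a < suc k → b < suc (suc k) → Υ-step k a b < suc k
Υ-step< {k} {a} {b} a<1+k _ with a <? b
... | yes _ = s≤s (∸-monoˡ-≤ 1 (m∸n≤m (suc k) a))
... | no  _ = ≤-<-trans (m∸n≤m a b) a<1+k

Υ-branches-disjoint : ∀ {k a a′ b} → a < suc k → a′ < suc k → a < b → b ≤ a′ → suc k ∸ a ∸ 1 ≢ a′ ∸ b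
Υ-branches-disjoint {k} {a} {a′} {b} a<1+k a′<1+k a<b b≤a′ eq = <-irrefl refl (begin-strict
  a′ ∸ b          ≤⟨ ∸-monoˡ-≤ b (≤-pred a′<1+k) ⟩
  k ∸ b           <⟨ ∸-monoʳ-< a<b (≤-trans b≤a′ (≤-pred a′<1+k)) ⟩
  k ∸ a           ≡⟨ cong (_∸ 1) (+-∸-assoc 1 (≤-pred a<1+k)) ⟨
  suc k ∸ a ∸ 1   ≡⟨ eq ⟩
  a′ ∸ b          ∎)
  where open ≤-Reasoning

Υ-step-injectiveˡ : ∀ {k a a′ b} → a < suc k → a′ < suc k → Υ-step k a b ≡ Υ-step k a′ b → a ≡ a′
Υ-step-injectiveˡ {k} {a} {a′} {b} a<1+k a′<1+k eq with a <? b | a′ <? b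
... | yes _   | yes _    = ∸-cancelˡ-≡ (<⇒≤ a<1+k) (<⇒≤ a′<1+k)
                             (∸-cancelʳ-≡ (m<n⇒0<n∸m a<1+k) (m<n⇒0<n∸m a′<1+k) eq)
... | no  a≮b | no  a′≮b = ∸-cancelʳ-≡ (≮⇒≥ a≮b) (≮⇒≥ a′≮b) eq
... | yes a<b | no  a′≮b = contradiction eq (Υ-branches-disjoint a<1+k a′<1+k a<b (≮⇒≥ a′≮b))
... | no  a≮b | yes a′<b = contradiction (sym eq) (Υ-branches-disjoint a′<1+k a<1+k a′<b (≮⇒≥ a≮b))

Ψ-step : ℕ → ℕ → ℕ
Ψ-step a b with a <? b
... | yes _ = b ∸ a ∸ 1
... | no  _ = a

Ψ-step< : ∀ {k a b} → a < suc k → b < suc (suc k) → Ψ-step a b < suc k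
Ψ-step< {k} {a} {b} a<1+k b<2+k with a <? b
... | yes _ = s≤s (∸-monoˡ-≤ 1 (≤-trans (m∸n≤m b a) (≤-pred b<2+k)))
... | no  _ = a<1+k

b∸a∸1<b : ∀ {a b} → a < b → b ∸ a ∸ 1 < b
b∸a∸1<b {a} {b} a<b = <-≤-trans (∸-monoʳ-< (s≤s z≤n) (m<n⇒0<n∸m a<b)) (m∸n≤m b a)

Ψ-step-injectiveˡ : ∀ {a a′ b} → Ψ-step a b ≡ Ψ-step a′ b → a ≡ a′
Ψ-step-injectiveˡ {a} {a′} {b} eq with a <? b | a′ <? b
... | yes a<b | yes a′<b = ∸-cancelˡ-≡ (<⇒≤ a<b) (<⇒≤ a′<b)
                             (∸-cancelʳ-≡ (m<n⇒0<n∸m a<b) (m<n⇒0<n∸m a′<b) eq)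
... | no  _   | no  _    = eq
... | yes a<b | no  a′≮b = contradiction (subst (_< b) eq (b∸a∸1<b a<b)) a′≮b
... | no  a≮b | yes a′<b = contradiction (subst (_< b) (sym eq) (b∸a∸1<b a′<b)) a≮b

module ΔF = Forward
  (λ k a b → (+ a ℤ.- + b) %ℕ suc k)
  (λ {k} {a} {b} _ _ → n%ℕd<d (+ a ℤ.- + b) (suc k))
  (λ {_} {_} {_} {b} a<1+k a′<1+k _ → -%ℕ-injectiveˡ (+ b) a<1+k a′<1+k)

module ΓB = Backward
  (λ k a b → (+ a ℤ.- + b) %ℕ suc (suc k))
  (λ {k} {a} {b} _ _ → n%ℕd<d (+ a ℤ.- + b) (suc (suc k)))
  (λ {_} {a} _ b<2+k b′<2+k → -%ℕ-injectiveʳ (+ a) b<2+k b′<2+k)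

module ΘB = Backward (λ _ → Θ-step) Θ-step< (λ {_} {a} _ _ _ → Θ-step-injectiveʳ {a})

module ΛB = Backward Λ-step Λ-step< (λ {k} {a} _ → Λ-step-injectiveʳ {k} {a})

module ΥF = Forward Υ-step Υ-step<
  (λ {_} {_} {_} {b} a<1+k a′<1+k _ → Υ-step-injectiveˡ {b = b} a<1+k a′<1+k)

module ΨF = Forward (λ _ → Ψ-step) Ψ-step< (λ {_} {_} {_} {b} _ _ _ → Ψ-step-injectiveˡ {b = b})

-- Δ n t unfolds to a tabulate whose entries are stuck on a decision (suc k <? n, …); rewriting
-- with get-tabulate exposes that decision to the with-abstraction, after which both sides compute
-- to the same term.
Δ≗forward : ∀ n → Δ n ≗ ΔF.forward n
Δ≗forward n t = tabulate-unique (Δ n t) entries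
  where
  entries : ∀ k p → get (Δ n t) k p ≡ ΔF.entry t k p (suc k <? n)
  entries k p rewrite get (Δ n t) k p ≡ _ ∋ get-tabulate _ k p with suc k <? n
  ... | yes _ = refl
  ... | no  _ = refl

Γ≗backward : ∀ n → Γ n ≗ ΓB.backward n
Γ≗backward n t = tabulate-unique (Γ n t) entries
  where
  entries : ∀ k p → get (Γ n t) k p ≡ ΓB.entry t k p
  entries zero    p rewrite get (Γ n t) zero p ≡ _ ∋ get-tabulate _ zero p = refl
  entries (suc k) p rewrite get (Γ n t) (suc k) p ≡ _ ∋ get-tabulate _ (suc k) p = refl

Θ≗backward : ∀ n → Θ n ≗ ΘB.backward n
Θ≗backward n t = tabulate-unique (Θ n t) entries
  where
  entries : ∀ k p → get (Θ n t) k p ≡ ΘB.entry t k p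
  entries zero    p rewrite get (Θ n t) zero p ≡ _ ∋ get-tabulate _ zero p = refl
  entries (suc k) p rewrite get (Θ n t) (suc k) p ≡ _ ∋ get-tabulate _ (suc k) p
    with val t (suc k) p ≤? val t k (<-trans (n<1+n k) p)
  ... | yes _ = refl
  ... | no  _ = refl

Λ≗backward : ∀ n → Λ n ≗ ΛB.backward n
Λ≗backward n t = tabulate-unique (Λ n t) entries
  where
  entries : ∀ k p → get (Λ n t) k p ≡ ΛB.entry t k p
  entries zero    p rewrite get (Λ n t) zero p ≡ _ ∋ get-tabulate _ zero p = refl
  entries (suc k) p rewrite get (Λ n t) (suc k) p ≡ _ ∋ get-tabulate _ (suc k) p
    with val t k (<-trans (n<1+n k) p) <? val t (suc k) p
  ... | yes _ = refl
  ... | no  _ = refl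

Υ≗forward : ∀ n → Υ n ≗ ΥF.forward n
Υ≗forward n t = tabulate-unique (Υ n t) entries
  where
  entries : ∀ k p → get (Υ n t) k p ≡ ΥF.entry t k p (suc k <? n)
  entries k p rewrite get (Υ n t) k p ≡ _ ∋ get-tabulate _ k p with suc k <? n
  ... | no  _ = refl
  ... | yes q with val t k p <? val t (suc k) q
  ...   | yes _ = refl
  ...   | no  _ = refl

Ψ≗forward : ∀ n → Ψ n ≗ ΨF.forward n
Ψ≗forward n t = tabulate-unique (Ψ n t) entries
  where
  entries : ∀ k p → get (Ψ n t) k p ≡ ΨF.entry t k p (suc k <? n)
  entries k p rewrite get (Ψ n t) k p ≡ _ ∋ get-tabulate _ k p with suc k <? n
  ... | no  _ = refl
  ... | yes q with val t k p <? val t (suc k) q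
  ...   | yes _ = refl
  ...   | no  _ = refl

proposition1 : ∀ n → 1 ≤ n →
    Bijective _≡_ _≡_ (Δ n) × Bijective _≡_ _≡_ (Γ n) × Bijective _≡_ _≡_ (Θ n)
      × Bijective _≡_ _≡_ (Λ n) × Bijective _≡_ _≡_ (Υ n) × Bijective _≡_ _≡_ (Ψ n)
proposition1 n _ =
  bijective-resp-≗ (Δ≗forward n)  (ΔF.forward-bijective n)  ,
  bijective-resp-≗ (Γ≗backward n) (ΓB.backward-bijective n) ,
  bijective-resp-≗ (Θ≗backward n) (ΘB.backward-bijective n) ,
  bijective-resp-≗ (Λ≗backward n) (ΛB.backward-bijective n) ,
  bijective-resp-≗ (Υ≗forward n)  (ΥF.forward-bijective n)  ,
  bijective-resp-≗ (Ψ≗forward n)  (ΨF.forward-bijective n)
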